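{- Let $n\ge 3$ and $1\le k<\frac{n}{2}$ be integers, and let $P(n,k)$ be the generalized Petersen graph. Then the co-spectrum of $P(n,k)$ (the set of sizes of its bonds) is exactly $\{3,4,5,\dots,n+2\}$.
   Context: The generalized Petersen graph $P(n,k)$ (for $n\ge 3$, $1\le k<n/2$) has vertex set $\{x_1,\dots,x_n,y_1,\dots,y_n\}$ and edge set $\{x_ix_{i+1},\ x_iy_i,\ y_iy_{i+k} : i=1,\dots,n\}$, with subscripts read modulo $n$. A bond of a graph is a minimal nonempty edge-cut; equivalently, for a connected graph $G$, a bond is the set $[X,Y]$ of edges between the parts of a partition $V(G)=X\cup Y$ into nonempty sets such that $G[X]$ and $G[Y]$ are both connected. The co-spectrum of a graph is the set of all sizes of its bonds. -}

module Defs where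

open import Data.Nat using (ℕ; zero; suc; _+_; _%_)
open import Data.Nat.DivMod using (m%n<n)
open import Data.Fin using (Fin; toℕ; fromℕ<)
open import Data.Bool using (Bool; true; false; if_then_else_; _xor_)
open import Data.List using (List; []; _∷_; concatMap; map; allFin)
open import Data.Nat.ListAction using (sum)
open import Data.List.Membership.Propositional using (_∈_)
open import Data.Product using (_×_; _,_; Σ; ∃)
open import Data.Sum using (_⊎_)
open import Relation.Binary.PropositionalEquality using (_≡_)

_⊕_ : {n : ℕ} → Fin n → ℕ → Fin n
_⊕_ {suc m} i j = fromℕ< (m%n<n (toℕ i + j) (suc m))

-- vertices of P(n,k): outer x_i and inner y_i (indices 0..n-1)
data Vtx (n : ℕ) : Set where
  xv : Fin n → Vtx n
  yv : Fin n → Vtx n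

-- edge list of P(n,k): for each i, x_i x_{i+1}, x_i y_i, y_i y_{i+k}
-- (for n ≥ 3, 1 ≤ k < n/2 these 3n edges are pairwise distinct)
edges : (n k : ℕ) → List (Vtx n × Vtx n)
edges n k = concatMap (λ i → (xv i , xv (i ⊕ 1)) ∷ (xv i , yv i) ∷ (yv i , yv (i ⊕ k)) ∷ []) (allFin n)

Adj : (n k : ℕ) → Vtx n → Vtx n → Set
Adj n k u v = ((u , v) ∈ edges n k) ⊎ ((v , u) ∈ edges n k)

-- a side of a vertex bipartition: X u ≡ true means u ∈ X, false means u ∈ Y
Side : ℕ → Set
Side n = Vtx n → Bool

data Walk (n k : ℕ) (X : Side n) (b : Bool) : Vtx n → Vtx n → Set where
  stop : ∀ {u} → X u ≡ b → Walk n k X b u u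
  step : ∀ {u w v} → X u ≡ b → Adj n k u w → Walk n k X b w v → Walk n k X b u v

InducedConnected : (n k : ℕ) → Side n → Bool → Set
InducedConnected n k X b =
  (Σ (Vtx n) λ u → X u ≡ b) ×
  (∀ u v → X u ≡ b → X v ≡ b → Walk n k X b u v)

IsBond : (n k : ℕ) → Side n → Set
IsBond n k X = InducedConnected n k X true × InducedConnected n k X false

cutSize : (n k : ℕ) → Side n → ℕ
cutSize n k X = sum (map (λ { (u , v) → if X u xor X v then 1 else 0 }) (edges n k))

InCoSpectrum : (n k : ℕ) → ℕ → Set
InCoSpectrum n k m = Σ (Side n) λ X → IsBond n k X × cutSize n k X ≡ m

-- If [X, Y] is a bond then P(n,k)[X] and P(n,k)[Y] are connected, so they contain at least |X| − 1 and
-- |Y| − 1 edges; since P(n,k) has 2n vertices and 3n edges, at most 3n − (2n − 2) = n + 2 edges are cut.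
-- Conversely P(n,k) is 3-edge-connected. If an outer edge is cut, the outer cycle is cut at least twice,
-- and either a spoke or inner edge is cut as well, or X is invariant under i ↦ i + k and the outer edges
-- at p, p + k, p + 2k (distinct as 2k < n) are all cut. If no outer edge is cut, some y_j lies on the other
-- side of the whole outer cycle, and inspecting y_{j−k}, y_j, y_{j+k}, y_{j+2k} exhibits three cut edges.
-- Finally every size j + r + 2 with 1 ≤ j ≤ n − k and r ≤ k, i.e. every size in [3, n + 2], is the size of
-- the bond of X = {x_i | i < j} ∪ {y_i | i < r}.

module Submission where

open import Defs
open import Data.Bool using (Bool; true; false; not; T; _xor_; _∧_; if_then_else_)
import Data.Bool as Bool
open import Data.Bool.Properties using (¬-not; not-injective; xor-identityʳ; ∧-identityʳ; ∧-zeroʳ)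
open import Data.Empty using (⊥)
open import Data.Fin as Fin using (Fin; toℕ)
open import Data.Fin.Properties using (any?; toℕ-injective; toℕ-fromℕ<; toℕ<n)
open import Data.List using (List; []; _∷_; _++_; map; concatMap; allFin; tabulate; length)
open import Data.List.Membership.Propositional using (_∈_; _∉_)
open import Data.List.Membership.Propositional.Properties using (∈-allFin; ∈-map⁻; ∈-concatMap⁺)
open import Data.List.Properties using (map-tabulate; map-++; length-map; length-++; length-tabulate)
open import Data.List.Relation.Unary.All using (All; []; _∷_)
import Data.List.Relation.Unary.All as All
import Data.List.Relation.Unary.All.Properties as All
open import Data.List.Relation.Unary.AllPairs using ([]; _∷_)
open import Data.List.Relation.Unary.Any using (here; there)
import Data.List.Relation.Unary.Any as Any
open import Data.List.Relation.Unary.Unique.Propositional using (Unique)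
import Data.List.Relation.Unary.Unique.Propositional.Properties as Unique
open import Data.Nat using (ℕ; zero; suc; _+_; _*_; _≤_; _<_; _∸_; _%_; z≤n; s≤s; s≤s⁻¹; _<ᵇ_; _≡ᵇ_)
open import Data.Nat.DivMod
open import Data.Nat.ListAction using (sum)
open import Data.Nat.ListAction.Properties using (sum-++)
open import Data.Nat.Properties
open import Algebra.Properties.CommutativeSemigroup +-commutativeSemigroup using (interchange; x∙yz≈y∙xz)
open import Data.Nat.Tactic.RingSolver using (solve-∀)
open import Data.Product using (_×_; _,_; proj₁; proj₂; Σ-syntax)
open import Data.Sum using (_⊎_; inj₁; inj₂)
open import Function using (_∘_)
open import Function.Bundles using (_⇔_; mk⇔)
open import Relation.Binary.Definitions using (DecidableEquality)
open import Relation.Binary.PropositionalEquality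
open import Relation.Nullary using (yes; no; Dec; contradiction)
open import Relation.Nullary.Decidable using (⌊_⌋; dec-true; dec-false)

𝟙 : Bool → ℕ
𝟙 b = if b then 1 else 0

𝟙≤1 : ∀ b → 𝟙 b ≤ 1
𝟙≤1 true  = ≤-refl
𝟙≤1 false = z≤n

xor-≢ : ∀ {x y : Bool} → x ≢ y → x xor y ≡ true
xor-≢ {true}  {true}  x≢y = contradiction refl x≢y
xor-≢ {true}  {false} _   = refl
xor-≢ {false} {true}  _   = refl
xor-≢ {false} {false} x≢y = contradiction refl x≢y

xor-true⇒≢ : ∀ {x y : Bool} → x xor y ≡ true → x ≢ y
xor-true⇒≢ {true}  {false} _ ()
xor-true⇒≢ {false} {true}  _ ()

xor-false⇒≡ : ∀ {x y : Bool} → x xor y ≡ false → x ≡ y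
xor-false⇒≡ {true}  {true}  _ = refl
xor-false⇒≡ {false} {false} _ = refl

𝟙-xor-⊆ : ∀ {x y} → (y ≡ true → x ≡ true) → 𝟙 (x xor y) + 𝟙 y ≡ 𝟙 x
𝟙-xor-⊆ {true}  {true}  _   = refl
𝟙-xor-⊆ {true}  {false} _   = refl
𝟙-xor-⊆ {false} {false} _   = refl
𝟙-xor-⊆ {false} {true}  y⇒x = contradiction (y⇒x refl) λ ()

<ᵇ-true : ∀ {i a} → i < a → (i <ᵇ a) ≡ true
<ᵇ-true {i} {a} = dec-true (i <? a)

<ᵇ-false : ∀ {i a} → a ≤ i → (i <ᵇ a) ≡ false
<ᵇ-false {i} {a} a≤i = dec-false (i <? a) (≤⇒≯ a≤i)

<ᵇ-true⁻ : ∀ {i a} → (i <ᵇ a) ≡ true → i < a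
<ᵇ-true⁻ {i} {a} e = <ᵇ⇒< i a (subst T (sym e) _)

<ᵇ-false⁻ : ∀ {i a} → (i <ᵇ a) ≡ false → a ≤ i
<ᵇ-false⁻ e = ≮⇒≥ λ i<a → subst T e (<⇒<ᵇ i<a)

≡ᵇ-refl : ∀ i → (i ≡ᵇ i) ≡ true
≡ᵇ-refl i = dec-true (i ≟ i) refl

≡ᵇ-false : ∀ {i a} → i ≢ a → (i ≡ᵇ a) ≡ false
≡ᵇ-false {i} {a} = dec-false (i ≟ a)

<ᵇ-+ˡ : ∀ d a b → (d + a <ᵇ d + b) ≡ (a <ᵇ b)
<ᵇ-+ˡ zero    a b = refl
<ᵇ-+ˡ (suc d) a b = <ᵇ-+ˡ d a b

<ᵇ-suc-xor : ∀ i j → (i <ᵇ suc j) xor (suc i <ᵇ suc j) ≡ (i ≡ᵇ j)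
<ᵇ-suc-xor zero    zero    = refl
<ᵇ-suc-xor zero    (suc j) = refl
<ᵇ-suc-xor (suc i) zero    = refl
<ᵇ-suc-xor (suc i) (suc j) = <ᵇ-suc-xor i j

change-below : ∀ (g : ℕ → Bool) n → g 0 ≢ g n → Σ[ u ∈ ℕ ] u < n × g u ≢ g (suc u)
change-below g zero    g0≢gn = contradiction refl g0≢gn
change-below g (suc n) g0≢gn with g 0 Bool.≟ g 1
... | no  g0≢g1 = 0 , s≤s z≤n , g0≢g1
... | yes g0≡g1 with change-below (g ∘ suc) n (λ g1≡gn → g0≢gn (trans g0≡g1 g1≡gn))
...   | u , u<n , gu≢gu+1 = suc u , s≤s u<n , gu≢gu+1

∑< : ℕ → (ℕ → ℕ) → ℕ
∑< zero    f = 0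
∑< (suc n) f = f 0 + ∑< n (f ∘ suc)

syntax ∑< n (λ i → e) = ∑[ i < n ] e

∑-cong : ∀ n {f g : ℕ → ℕ} → (∀ i → i < n → f i ≡ g i) → ∑< n f ≡ ∑< n g
∑-cong zero    f≗g = refl
∑-cong (suc n) f≗g = cong₂ _+_ (f≗g 0 (s≤s z≤n)) (∑-cong n (λ i i<n → f≗g (suc i) (s≤s i<n)))

∑-distrib-+ : ∀ n (f g : ℕ → ℕ) → ∑[ i < n ] (f i + g i) ≡ ∑< n f + ∑< n g
∑-distrib-+ zero    f g = refl
∑-distrib-+ (suc n) f g =
  trans (cong (f 0 + g 0 +_) (∑-distrib-+ n (f ∘ suc) (g ∘ suc))) (interchange (f 0) (g 0) _ _)

∑-const : ∀ n c → ∑[ i < n ] c ≡ n * c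
∑-const zero    c = refl
∑-const (suc n) c = cong (c +_) (∑-const n c)

∑-≡ᵇ : ∀ n {c} → c < n → ∑[ i < n ] 𝟙 (i ≡ᵇ c) ≡ 1
∑-≡ᵇ (suc n) {zero}  _         = cong suc (trans (∑-const n 0) (*-zeroʳ n))
∑-≡ᵇ (suc n) {suc c} (s≤s c<n) = ∑-≡ᵇ n c<n

∑-<ᵇ : ∀ n {a} → a ≤ n → ∑[ i < n ] 𝟙 (i <ᵇ a) ≡ a
∑-<ᵇ n       {zero}  _         = trans (∑-const n 0) (*-zeroʳ n)
∑-<ᵇ (suc n) {suc a} (s≤s a≤n) = cong suc (∑-<ᵇ n a≤n)

erase : (ℕ → ℕ) → ℕ → ℕ → ℕ
erase f p i = if i ≡ᵇ p then 0 else f i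

∑-erase : ∀ n (f : ℕ → ℕ) {p} → p < n → ∑< n f ≡ f p + ∑< n (erase f p)
∑-erase (suc n) f {zero}  _         = refl
∑-erase (suc n) f {suc p} (s≤s p<n) =
  trans (cong (f 0 +_) (∑-erase n (f ∘ suc) p<n)) (x∙yz≈y∙xz (f 0) (f (suc p)) _)

erase-≢ : ∀ (f : ℕ → ℕ) {p q} → q ≢ p → erase f p q ≡ f q
erase-≢ f q≢p rewrite ≡ᵇ-false q≢p = refl

∑-≥-length : ∀ n (f : ℕ → ℕ) {ps : List ℕ} → Unique ps → All (_< n) ps → All (λ p → 1 ≤ f p) ps →
  length ps ≤ ∑< n f
∑-≥-length n f                []                    []           []         = z≤n
∑-≥-length n f {p ∷ ps} (p≢ps ∷ uniq) (p<n ∷ ps<n) (fp ∷ fps) = begin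
  suc (length ps)        ≤⟨ +-mono-≤ fp (∑-≥-length n (erase f p) uniq ps<n erased-positive) ⟩
  f p + ∑< n (erase f p) ≡⟨ ∑-erase n f p<n ⟨
  ∑< n f                 ∎
  where
  open ≤-Reasoning
  erased-positive : All (λ q → 1 ≤ erase f p q) ps
  erased-positive = All.zipWith (λ (p≢q , fq) → subst (1 ≤_) (sym (erase-≢ f (p≢q ∘ sym))) fq) (p≢ps , fps)

sum-map-cong : ∀ {A : Set} {f g : A → ℕ} xs → (∀ x → f x ≡ g x) → sum (map f xs) ≡ sum (map g xs)
sum-map-cong []       f≗g = refl
sum-map-cong (x ∷ xs) f≗g = cong₂ _+_ (f≗g x) (sum-map-cong xs f≗g)

sum-map-mono-≤ : ∀ {A : Set} {f g : A → ℕ} xs → (∀ x → f x ≤ g x) → sum (map f xs) ≤ sum (map g xs)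
sum-map-mono-≤ []       f≤g = z≤n
sum-map-mono-≤ (x ∷ xs) f≤g = +-mono-≤ (f≤g x) (sum-map-mono-≤ xs f≤g)

sum-map-+ : ∀ {A : Set} (f g : A → ℕ) xs → sum (map (λ x → f x + g x) xs) ≡ sum (map f xs) + sum (map g xs)
sum-map-+ f g []       = refl
sum-map-+ f g (x ∷ xs) = trans (cong (f x + g x +_) (sum-map-+ f g xs)) (interchange (f x) (g x) _ _)

sum-map-1 : ∀ {A : Set} (xs : List A) → sum (map (λ _ → 1) xs) ≡ length xs
sum-map-1 []       = refl
sum-map-1 (_ ∷ xs) = cong suc (sum-map-1 xs)

sum-concatMap : ∀ {A B : Set} (h : B → ℕ) (g : A → List B) xs →
  sum (map h (concatMap g xs)) ≡ sum (map (λ x → sum (map h (g x))) xs)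
sum-concatMap h g []       = refl
sum-concatMap h g (x ∷ xs) = begin
  sum (map h (g x ++ concatMap g xs))                        ≡⟨ cong sum (map-++ h (g x) (concatMap g xs)) ⟩
  sum (map h (g x) ++ map h (concatMap g xs))                ≡⟨ sum-++ (map h (g x)) _ ⟩
  sum (map h (g x)) + sum (map h (concatMap g xs))           ≡⟨ cong (sum (map h (g x)) +_) (sum-concatMap h g xs) ⟩
  sum (map h (g x)) + sum (map (λ x → sum (map h (g x))) xs) ∎
  where open ≡-Reasoning

sum-tabulate : ∀ n {G : Fin n → ℕ} {H : ℕ → ℕ} → (∀ f → G f ≡ H (toℕ f)) → sum (tabulate G) ≡ ∑< n H
sum-tabulate zero    G≗H = refl
sum-tabulate (suc n) G≗H = cong₂ _+_ (G≗H Fin.zero) (sum-tabulate n (G≗H ∘ Fin.suc))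

module _ {V : Set} (_≟_ : DecidableEquality V) where

  occurrences : V → List V → ℕ
  occurrences p vs = sum (map (λ u → 𝟙 ⌊ u ≟ p ⌋) vs)

  occurrences-∉ : ∀ {p} vs → p ∉ vs → occurrences p vs ≡ 0
  occurrences-∉     []       p∉vs = refl
  occurrences-∉ {p} (u ∷ vs) p∉vs with u ≟ p
  ... | yes refl = contradiction (here refl) p∉vs
  ... | no  _    = occurrences-∉ vs (p∉vs ∘ there)

  occurrences-unique : ∀ p {vs} → Unique vs → occurrences p vs ≤ 1
  occurrences-unique p []                       = z≤n
  occurrences-unique p {u ∷ vs} uniq@(_ ∷ uniq′) with u ≟ p
  ... | yes refl = ≤-reflexive (cong suc (occurrences-∉ vs (Unique.Unique[x∷xs]⇒x∉xs uniq)))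
  ... | no  _    = occurrences-unique p uniq′

-- Connected graphs on s vertices have at least s − 1 edges

module ConnectedSubgraph {V : Set} (_≟_ : DecidableEquality V) (vs : List V) (vs-unique : Unique vs)
                         (S : V → Bool) where

  Adjacent : List (V × V) → V → V → Set
  Adjacent E u w = (u , w) ∈ E ⊎ (w , u) ∈ E

  data WalkIn (E : List (V × V)) : V → V → Set where
    stop : ∀ {u} → S u ≡ true → WalkIn E u u
    step : ∀ {u w v} → S u ≡ true → Adjacent E u w → WalkIn E w v → WalkIn E u v

  walkIn-start : ∀ {E u v} → WalkIn E u v → S u ≡ true
  walkIn-start (stop Su)     = Su
  walkIn-start (step Su _ _) = Su

  ThroughEdge : V → V → List (V × V) → V → V → Set
  ThroughEdge a b E u v =
    S a ≡ true × S b ≡ true × (WalkIn E u a ⊎ WalkIn E u b) × (WalkIn E a v ⊎ WalkIn E b v)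

  walkIn-prepend : ∀ {a b E u w v} → S u ≡ true → Adjacent E u w →
    WalkIn E w v ⊎ ThroughEdge a b E w v → WalkIn E u v ⊎ ThroughEdge a b E u v
  walkIn-prepend Su uw (inj₁ w→v)                       = inj₁ (step Su uw w→v)
  walkIn-prepend Su uw (inj₂ (Sa , Sb , inj₁ w→a , →v)) = inj₂ (Sa , Sb , inj₁ (step Su uw w→a) , →v)
  walkIn-prepend Su uw (inj₂ (Sa , Sb , inj₂ w→b , →v)) = inj₂ (Sa , Sb , inj₂ (step Su uw w→b) , →v)

  walkIn-∷ : ∀ {a b E u v} → WalkIn ((a , b) ∷ E) u v → WalkIn E u v ⊎ ThroughEdge a b E u v
  walkIn-∷ (stop Su) = inj₁ (stop Su)
  walkIn-∷ (step Sa (inj₁ (here refl)) rest) with walkIn-∷ rest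
  ... | inj₁ b→v                  = inj₂ (Sa , walkIn-start b→v , inj₁ (stop Sa) , inj₂ b→v)
  ... | inj₂ (Sa′ , Sb , _ , →v) = inj₂ (Sa′ , Sb , inj₁ (stop Sa) , →v)
  walkIn-∷ (step Sb (inj₂ (here refl)) rest) with walkIn-∷ rest
  ... | inj₁ a→v                  = inj₂ (walkIn-start a→v , Sb , inj₂ (stop Sb) , inj₁ a→v)
  ... | inj₂ (Sa , Sb′ , _ , →v) = inj₂ (Sa , Sb′ , inj₂ (stop Sb) , →v)
  walkIn-∷ (step Su (inj₁ (there uw)) rest) = walkIn-prepend Su (inj₁ uw) (walkIn-∷ rest)
  walkIn-∷ (step Su (inj₂ (there wu)) rest) = walkIn-prepend Su (inj₂ wu) (walkIn-∷ rest)

  -- Union–find: `label E` maps every vertex to a representative of its component in the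
  -- subgraph induced by S with edge set E; an edge inside S merges the class of b into that of a.
  relabel : (V → V) → V → V → V → V
  relabel c x y u = if ⌊ c u ≟ y ⌋ then x else c u

  link : Bool → (V → V) → V → V → V → V
  link true  c a b = relabel c (c a) (c b)
  link false c a b = c

  label : List (V × V) → V → V
  label []            u = u
  label ((a , b) ∷ E)   = link (S a ∧ S b) (label E) a b

  link-cong : ∀ β c a b {u v} → c u ≡ c v → link β c a b u ≡ link β c a b v
  link-cong true  c a b cu≡cv rewrite cu≡cv = refl
  link-cong false c a b cu≡cv = cu≡cv

  relabel-merges : ∀ c a b w → c w ≡ c a ⊎ c w ≡ c b → relabel c (c a) (c b) w ≡ c a
  relabel-merges c a b w cw with c w ≟ c b
  ... | yes _ = refl
  ... | no cw≢cb with cw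
  ...   | inj₁ cw≡ca = cw≡ca
  ...   | inj₂ cw≡cb = contradiction cw≡cb cw≢cb

  label-walk : ∀ E {u v} → WalkIn E u v → label E u ≡ label E v
  label-walk []            (stop _)                  = refl
  label-walk []            (step _ (inj₁ ()) _)
  label-walk []            (step _ (inj₂ ()) _)
  label-walk ((a , b) ∷ E) {u} {v} u→v with walkIn-∷ u→v
  ... | inj₁ u→v′ = link-cong (S a ∧ S b) (label E) a b (label-walk E u→v′)
  ... | inj₂ (Sa , Sb , u→ab , ab→v) rewrite Sa | Sb =
    trans (relabel-merges (label E) a b u (from-u u→ab)) (sym (relabel-merges (label E) a b v (from-v ab→v)))
    where
    from-u : WalkIn E u a ⊎ WalkIn E u b → label E u ≡ label E a ⊎ label E u ≡ label E b
    from-u (inj₁ u→a) = inj₁ (label-walk E u→a)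
    from-u (inj₂ u→b) = inj₂ (label-walk E u→b)
    from-v : WalkIn E a v ⊎ WalkIn E b v → label E v ≡ label E a ⊎ label E v ≡ label E b
    from-v (inj₁ a→v) = inj₁ (sym (label-walk E a→v))
    from-v (inj₂ b→v) = inj₂ (sym (label-walk E b→v))

  isRoot : (V → V) → V → Bool
  isRoot c u = S u ∧ ⌊ c u ≟ u ⌋

  roots : (V → V) → ℕ
  roots c = sum (map (𝟙 ∘ isRoot c) vs)

  size : ℕ
  size = sum (map (𝟙 ∘ S) vs)

  internalEdges : List (V × V) → ℕ
  internalEdges E = sum (map (λ e → 𝟙 (S (proj₁ e) ∧ S (proj₂ e))) E)

  roots-id : roots (λ u → u) ≡ size
  roots-id = sum-map-cong vs isRoot-id
    where
    isRoot-id : ∀ u → 𝟙 (isRoot (λ u → u) u) ≡ 𝟙 (S u)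
    isRoot-id u with u ≟ u
    ... | yes _   = cong 𝟙 (∧-identityʳ (S u))
    ... | no  u≢u = contradiction refl u≢u

  relabel-isRoot : ∀ c x y u → 𝟙 (isRoot c u) ≤ 𝟙 (isRoot (relabel c x y) u) + 𝟙 ⌊ u ≟ y ⌋
  relabel-isRoot c x y u with c u ≟ u
  ... | no _ rewrite ∧-zeroʳ (S u) = z≤n
  ... | yes cu≡u with c u ≟ y
  ...   | yes cu≡y with u ≟ y
  ...     | yes _   = ≤-trans (𝟙≤1 _) (m≤n+m 1 _)
  ...     | no u≢y = contradiction (trans (sym cu≡u) cu≡y) u≢y
  relabel-isRoot c x y u | yes cu≡u | no _ rewrite cu≡u with u ≟ u
  ...     | yes _   = m≤m+n _ _
  ...     | no u≢u = contradiction refl u≢u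

  -- Each merge removes at most one root, the vertex c b (which occurs once in vs).
  roots-link : ∀ β c a b → roots c ≤ roots (link β c a b) + 𝟙 β
  roots-link false c a b = m≤m+n _ _
  roots-link true  c a b = begin
    roots c                                               ≤⟨ sum-map-mono-≤ vs (relabel-isRoot c (c a) (c b)) ⟩
    sum (map (λ u → 𝟙 (isRoot c′ u) + 𝟙 ⌊ u ≟ c b ⌋) vs) ≡⟨ sum-map-+ (𝟙 ∘ isRoot c′) _ vs ⟩
    roots c′ + occurrences _≟_ (c b) vs                   ≤⟨ +-monoʳ-≤ (roots c′) (occurrences-unique _≟_ (c b) vs-unique) ⟩
    roots c′ + 1                                          ∎
    where
    open ≤-Reasoning
    c′ = relabel c (c a) (c b)

  size≤roots+internalEdges : ∀ E → size ≤ roots (label E) + internalEdges E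
  size≤roots+internalEdges []            = ≤-reflexive (sym (trans (+-identityʳ _) roots-id))
  size≤roots+internalEdges ((a , b) ∷ E) = begin
    size                                               ≤⟨ size≤roots+internalEdges E ⟩
    roots (label E) + internalEdges E                  ≤⟨ +-monoˡ-≤ (internalEdges E) (roots-link Sab (label E) a b) ⟩
    roots (label E′) + 𝟙 Sab + internalEdges E         ≡⟨ +-assoc (roots (label E′)) (𝟙 Sab) (internalEdges E) ⟩
    roots (label E′) + internalEdges E′                ∎
    where
    open ≤-Reasoning
    E′ = (a , b) ∷ E
    Sab = S a ∧ S b

  connected⇒size≤1+internalEdges : ∀ E {u₀} → S u₀ ≡ true →
    (∀ u v → S u ≡ true → S v ≡ true → WalkIn E u v) → size ≤ 1 + internalEdges E
  connected⇒size≤1+internalEdges E {u₀} Su₀ connected =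
    ≤-trans (size≤roots+internalEdges E) (+-monoˡ-≤ (internalEdges E) roots≤1)
    where
    root-is-label-u₀ : ∀ u → 𝟙 (isRoot (label E) u) ≤ 𝟙 ⌊ u ≟ label E u₀ ⌋
    root-is-label-u₀ u with S u in Su | label E u ≟ u
    ... | false | _   = z≤n
    ... | true  | no _ = z≤n
    ... | true  | yes root with u ≟ label E u₀
    ...   | yes _ = ≤-refl
    ...   | no u≢ = contradiction (trans (sym root) (label-walk E (connected u u₀ Su Su₀))) u≢
    roots≤1 : roots (label E) ≤ 1
    roots≤1 = ≤-trans (sum-map-mono-≤ vs root-is-label-u₀) (occurrences-unique _≟_ (label E u₀) vs-unique)

-- Arithmetic modulo N = suc m

module Residues (m : ℕ) where

  N : ℕ
  N = suc m

  %-distribˡ-+ʳ : ∀ a t → (a + t) % N ≡ (a % N + t) % N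
  %-distribˡ-+ʳ a t = trans (%-distribˡ-+ a t N)
    (sym (trans (%-distribˡ-+ (a % N) t N) (cong (λ r → (r + t % N) % N) (m%n%n≡m%n a N))))

  %-shift-≢ : ∀ a {t} → 0 < t → t < N → a % N ≢ (a + t) % N
  %-shift-≢ a {t} 0<t t<N eq with a % N + t <? N
  ... | yes r+t<N = <⇒≢ (m<m+n (a % N) 0<t) (trans eq (trans (%-distribˡ-+ʳ a t) (m<n⇒m%n≡m r+t<N)))
  ... | no  r+t≮N = <⇒≢ t<N (sym (+-cancelˡ-≡ (a % N) N t (begin
      a % N + N     ≡⟨ cong (_+ N) r≡w ⟩
      w + N         ≡⟨ m∸n+n≡m (≮⇒≥ r+t≮N) ⟩
      a % N + t     ∎)))
    where
    open ≡-Reasoning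
    w = a % N + t ∸ N
    w<N : w < N
    w<N = m<n+o⇒m∸n<o (a % N + t) N (+-mono-< (m%n<n a N) t<N)
    r≡w : a % N ≡ w
    r≡w = begin
      a % N                 ≡⟨ eq ⟩
      (a + t) % N           ≡⟨ %-distribˡ-+ʳ a t ⟩
      (a % N + t) % N       ≡⟨ cong (_% N) (m∸n+n≡m (≮⇒≥ r+t≮N)) ⟨
      (w + N) % N           ≡⟨ [m+n]%n≡m%n w N ⟩
      w % N                 ≡⟨ m<n⇒m%n≡m w<N ⟩
      w                     ∎

  toℕ-mod : ∀ i → toℕ (i mod N) ≡ i % N
  toℕ-mod i = toℕ-fromℕ< (m%n<n i N)

  mod-cong : ∀ a b → a % N ≡ b % N → a mod N ≡ b mod N
  mod-cong a b eq = toℕ-injective (trans (toℕ-mod a) (trans eq (sym (toℕ-mod b))))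

  toℕ-mod-inverse : ∀ (f : Fin N) → toℕ f mod N ≡ f
  toℕ-mod-inverse f = toℕ-injective (trans (toℕ-mod (toℕ f)) (m<n⇒m%n≡m (toℕ<n f)))

  mod-⊕ : ∀ i t → (i mod N) ⊕ t ≡ (i + t) mod N
  mod-⊕ i t = mod-cong (toℕ (i mod N) + t) (i + t)
    (trans (cong (λ r → (r + t) % N) (toℕ-mod i)) (sym (%-distribˡ-+ʳ i t)))

  %-cong-+ʳ : ∀ a b t → a % N ≡ b % N → (a + t) % N ≡ (b + t) % N
  %-cong-+ʳ a b t eq = trans (%-distribˡ-+ʳ a t) (trans (cong (λ r → (r + t) % N) eq) (sym (%-distribˡ-+ʳ b t)))

  ModCongruent : (ℕ → Bool) → Set
  ModCongruent P = ∀ a b → a % N ≡ b % N → P a ≡ P b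

  count : (ℕ → Bool) → ℕ
  count P = ∑[ i < N ] 𝟙 (P i)

  count-≥ : ∀ {P} → ModCongruent P → ∀ ps → Unique (map (_% N) ps) → All (λ p → P p ≡ true) ps →
    length ps ≤ count P
  count-≥ {P} P-cong ps uniq Pps = begin
    length ps              ≡⟨ length-map (_% N) ps ⟨
    length (map (_% N) ps) ≤⟨ ∑-≥-length N (𝟙 ∘ P) uniq residues<N positive ⟩
    count P                ∎
    where
    open ≤-Reasoning
    residues<N : All (_< N) (map (_% N) ps)
    residues<N = All.map⁺ (All.tabulate (λ {p} _ → m%n<n p N))
    positive : All (λ r → 1 ≤ 𝟙 (P r)) (map (_% N) ps)
    positive = All.map⁺ (All.map (λ {p} Pp → ≤-reflexive (cong 𝟙 (sym (trans (P-cong (p % N) p (m%n%n≡m%n p N)) Pp))))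
                                 Pps)

  count-≥1 : ∀ {P} → ModCongruent P → ∀ p → P p ≡ true → 1 ≤ count P
  count-≥1 P-cong p Pp = count-≥ P-cong (p ∷ []) ([] ∷ []) (Pp ∷ [])

  count-≥2 : ∀ {P} → ModCongruent P → ∀ p q → p % N ≢ q % N → P p ≡ true → P q ≡ true → 2 ≤ count P
  count-≥2 P-cong p q p≢q Pp Pq = count-≥ P-cong (p ∷ q ∷ []) ((p≢q ∷ []) ∷ [] ∷ []) (Pp ∷ Pq ∷ [])

  all-false-or-some-true : ∀ {P} → ModCongruent P → (∀ i → P i ≡ false) ⊎ Σ[ p ∈ ℕ ] P p ≡ true
  all-false-or-some-true {P} P-cong with any? (λ (f : Fin N) → P (toℕ f) Bool.≟ true)
  ... | yes (f , Pf) = inj₂ (toℕ f , Pf)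
  ... | no  ¬∃       = inj₁ λ i →
    trans (P-cong i (toℕ (i mod N)) (sym (trans (cong (_% N) (toℕ-mod i)) (m%n%n≡m%n i N))))
          (¬-not (λ Pi → ¬∃ (i mod N , Pi)))

  another-change : ∀ {c} → ModCongruent c → ∀ p → c p ≢ c (p + 1) →
    Σ[ q ∈ ℕ ] p % N ≢ q % N × c q ≢ c (q + 1)
  another-change {c} c-cong p cp≢cp+1 with change-below (λ i → c (p + 1 + i)) m ends-differ
    where
    ends-differ : c (p + 1 + 0) ≢ c (p + 1 + m)
    ends-differ e = cp≢cp+1 (sym (begin
      c (p + 1)     ≡⟨ cong c (+-identityʳ (p + 1)) ⟨
      c (p + 1 + 0) ≡⟨ e ⟩
      c (p + 1 + m) ≡⟨ cong c (+-assoc p 1 m) ⟩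
      c (p + N)     ≡⟨ c-cong (p + N) p ([m+n]%n≡m%n p N) ⟩
      c p           ∎))
      where open ≡-Reasoning
  ... | u , u<m , change = p + suc u , %-shift-≢ p (s≤s z≤n) (s≤s u<m) , λ e → change (begin
      c (p + 1 + u)     ≡⟨ cong c (+-assoc p 1 u) ⟩
      c (p + suc u)     ≡⟨ e ⟩
      c (p + suc u + 1) ≡⟨ cong c (trans (+-assoc p (suc u) 1) (cong (p +_) (+-comm (suc u) 1))) ⟩
      c (p + (1 + suc u)) ≡⟨ cong c (+-assoc p 1 (suc u)) ⟨
      c (p + 1 + suc u) ∎)
    where open ≡-Reasoning

-- The generalized Petersen graph

_≟ᵥ_ : ∀ {n} → DecidableEquality (Vtx n)
xv f ≟ᵥ xv g with f Fin.≟ g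
... | yes refl = yes refl
... | no  f≢g  = no λ { refl → f≢g refl }
xv f ≟ᵥ yv g = no λ ()
yv f ≟ᵥ xv g = no λ ()
yv f ≟ᵥ yv g with f Fin.≟ g
... | yes refl = yes refl
... | no  f≢g  = no λ { refl → f≢g refl }

vertices : ∀ n → List (Vtx n)
vertices n = map xv (allFin n) ++ map yv (allFin n)

vertices-unique : ∀ n → Unique (vertices n)
vertices-unique n = Unique.++⁺ (Unique.map⁺ xv-injective (Unique.allFin⁺ n))
                               (Unique.map⁺ yv-injective (Unique.allFin⁺ n)) disjoint
  where
  xv-injective : ∀ {f g : Fin n} → xv f ≡ xv g → f ≡ g
  xv-injective refl = refl
  yv-injective : ∀ {f g : Fin n} → yv f ≡ yv g → f ≡ g
  yv-injective refl = refl
  disjoint : ∀ {u} → u ∈ map xv (allFin n) × u ∈ map yv (allFin n) → ⊥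
  disjoint (u∈xs , u∈ys) with ∈-map⁻ xv u∈xs | ∈-map⁻ yv u∈ys
  ... | _ , _ , refl | _ , _ , ()

length-vertices : ∀ n → length (vertices n) ≡ n + n
length-vertices n = trans (length-++ (map xv (allFin n)))
  (cong₂ _+_ (trans (length-map xv (allFin n)) length-allFin) (trans (length-map yv (allFin n)) length-allFin))
  where
  length-allFin : length (allFin n) ≡ n
  length-allFin = length-tabulate {n = n} (λ f → f)

Adj-sym : ∀ {n k u v} → Adj n k u v → Adj n k v u
Adj-sym (inj₁ uv) = inj₂ uv
Adj-sym (inj₂ vu) = inj₁ vu

module _ {n k : ℕ} {X : Side n} {b : Bool} where

  walk-start : ∀ {u v} → Walk n k X b u v → X u ≡ b
  walk-start (stop Xu)     = Xu
  walk-start (step Xu _ _) = Xu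

  _++ʷ_ : ∀ {u w v} → Walk n k X b u w → Walk n k X b w v → Walk n k X b u v
  stop _         ++ʷ w→v = w→v
  step Xu uw u→w ++ʷ w→v = step Xu uw (u→w ++ʷ w→v)

  reverseʷ : ∀ {u v} → Walk n k X b u v → Walk n k X b v u
  reverseʷ (stop Xu)        = stop Xu
  reverseʷ (step Xu uw w→v) = reverseʷ w→v ++ʷ step (walk-start w→v) (Adj-sym uw) (stop Xu)

  connected-via-hub : ∀ h → (∀ u → X u ≡ b → Walk n k X b u h) →
    ∀ u v → X u ≡ b → X v ≡ b → Walk n k X b u v
  connected-via-hub h to-h u v Xu Xv = to-h u Xu ++ʷ reverseʷ (to-h v Xv)

module PetersenGraph (m k : ℕ) where
  open Residues m

  edgesAt : Fin N → List (Vtx N × Vtx N)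
  edgesAt i = (xv i , xv (i ⊕ 1)) ∷ (xv i , yv i) ∷ (yv i , yv (i ⊕ k)) ∷ []

  sum-edges : ∀ (h : Vtx N × Vtx N → ℕ) →
    sum (map h (edges N k)) ≡ ∑[ i < N ] sum (map h (edgesAt (i mod N)))
  sum-edges h = begin
    sum (map h (edges N k))                  ≡⟨ sum-concatMap h edgesAt (allFin N) ⟩
    sum (map H (allFin N))                   ≡⟨ cong sum (map-tabulate (λ f → f) H) ⟩
    sum (tabulate H)                         ≡⟨ sum-tabulate N {H = H ∘ (_mod N)} (cong H ∘ sym ∘ toℕ-mod-inverse) ⟩
    ∑[ i < N ] sum (map h (edgesAt (i mod N))) ∎
    where
    open ≡-Reasoning
    H : Fin N → ℕ
    H f = sum (map h (edgesAt f))

  edgesAt⊆edges : ∀ i {e} → e ∈ edgesAt i → e ∈ edges N k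
  edgesAt⊆edges i e∈ = ∈-concatMap⁺ edgesAt (Any.map (λ { refl → e∈ }) (∈-allFin i))

  outer-step : ∀ i → Adj N k (xv (i mod N)) (xv (suc i mod N))
  outer-step i = subst (λ f → Adj N k (xv (i mod N)) (xv f)) (trans (mod-⊕ i 1) (cong (_mod N) (+-comm i 1)))
                   (inj₁ (edgesAt⊆edges (i mod N) (here refl)))

  spoke : ∀ i → Adj N k (xv (i mod N)) (yv (i mod N))
  spoke i = inj₁ (edgesAt⊆edges (i mod N) (there (here refl)))

  inner-step : ∀ i → Adj N k (yv (i mod N)) (yv ((i + k) mod N))
  inner-step i = subst (λ f → Adj N k (yv (i mod N)) (yv f)) (mod-⊕ i k)
                   (inj₁ (edgesAt⊆edges (i mod N) (there (there (here refl)))))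

  walks-by-index : ∀ {X b h} →
    (∀ i → i < N → X (xv (i mod N)) ≡ b → Walk N k X b (xv (i mod N)) h) →
    (∀ i → i < N → X (yv (i mod N)) ≡ b → Walk N k X b (yv (i mod N)) h) →
    ∀ u → X u ≡ b → Walk N k X b u h
  walks-by-index from-x from-y (xv f) Xf rewrite sym (toℕ-mod-inverse f) = from-x (toℕ f) (toℕ<n f) Xf
  walks-by-index from-x from-y (yv f) Xf rewrite sym (toℕ-mod-inverse f) = from-y (toℕ f) (toℕ<n f) Xf

  module Sides (X : Side N) where

    outerSide innerSide : ℕ → Bool
    outerSide i = X (xv (i mod N))
    innerSide i = X (yv (i mod N))

    outerCut spokeCut innerCut : ℕ → Bool
    outerCut i = outerSide i xor outerSide (i + 1)
    spokeCut i = outerSide i xor innerSide i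
    innerCut i = innerSide i xor innerSide (i + k)

    outerSide-cong : ModCongruent outerSide
    outerSide-cong a b e = cong (X ∘ xv) (mod-cong a b e)

    innerSide-cong : ModCongruent innerSide
    innerSide-cong a b e = cong (X ∘ yv) (mod-cong a b e)

    outerCut-cong : ModCongruent outerCut
    outerCut-cong a b e = cong₂ _xor_ (outerSide-cong a b e) (outerSide-cong (a + 1) (b + 1) (%-cong-+ʳ a b 1 e))

    spokeCut-cong : ModCongruent spokeCut
    spokeCut-cong a b e = cong₂ _xor_ (outerSide-cong a b e) (innerSide-cong a b e)

    innerCut-cong : ModCongruent innerCut
    innerCut-cong a b e = cong₂ _xor_ (innerSide-cong a b e) (innerSide-cong (a + k) (b + k) (%-cong-+ʳ a b k e))

    cutSize≡ : cutSize N k X ≡ count outerCut + count spokeCut + count innerCut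
    cutSize≡ = begin
      sum (map isCut (edges N k))                                      ≡⟨ sum-edges isCut ⟩
      ∑[ i < N ] sum (map isCut (edgesAt (i mod N)))                   ≡⟨ ∑-cong N (λ i _ → cuts-at i) ⟩
      ∑[ i < N ] (𝟙 (outerCut i) + spoke+inner i)                      ≡⟨ ∑-distrib-+ N (𝟙 ∘ outerCut) spoke+inner ⟩
      count outerCut + ∑< N spoke+inner                                ≡⟨ cong (count outerCut +_)
                                                                            (∑-distrib-+ N (𝟙 ∘ spokeCut) (𝟙 ∘ innerCut)) ⟩
      count outerCut + (count spokeCut + count innerCut)               ≡⟨ +-assoc (count outerCut) _ _ ⟨
      count outerCut + count spokeCut + count innerCut                 ∎
      where
      open ≡-Reasoning
      isCut : Vtx N × Vtx N → ℕ
      isCut (u , v) = 𝟙 (X u xor X v)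
      spoke+inner : ℕ → ℕ
      spoke+inner i = 𝟙 (spokeCut i) + 𝟙 (innerCut i)
      cuts-at : ∀ i → sum (map isCut (edgesAt (i mod N))) ≡ 𝟙 (outerCut i) + (𝟙 (spokeCut i) + 𝟙 (innerCut i))
      cuts-at i rewrite mod-⊕ i 1 | mod-⊕ i k | +-identityʳ (𝟙 (innerCut i)) = refl

    module LowerBound (0<k : 0 < k) (2k<N : k + k < N) where

      k<N : k < N
      k<N = m+n≤o⇒m≤o (suc k) 2k<N

      p≢p+k : ∀ p → p % N ≢ (p + k) % N
      p≢p+k p = %-shift-≢ p 0<k k<N

      three-apart : ∀ p → Unique (map (_% N) (p ∷ p + k ∷ p + k + k ∷ []))
      three-apart p = (p≢p+k p ∷ p≢p+2k ∷ []) ∷ (p≢p+k (p + k) ∷ []) ∷ [] ∷ []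
        where
        p≢p+2k : p % N ≢ (p + k + k) % N
        p≢p+2k e = %-shift-≢ p (≤-trans 0<k (m≤m+n k k)) 2k<N (trans e (cong (_% N) (+-assoc p k k)))

      cutSize-≥ : ∀ {a b c} → a ≤ count outerCut → b ≤ count spokeCut → c ≤ count innerCut →
        a + b + c ≤ cutSize N k X
      cutSize-≥ {a} {b} {c} a≤ b≤ c≤ = subst (a + b + c ≤_) (sym cutSize≡) (+-mono-≤ (+-mono-≤ a≤ b≤) c≤)

      two-outerCuts : ∀ p → outerCut p ≡ true → 2 ≤ count outerCut
      two-outerCuts p cut-p with another-change outerSide-cong p (xor-true⇒≢ cut-p)
      ... | q , p≢q , change = count-≥2 outerCut-cong p q p≢q cut-p (xor-≢ change)

      outerCut-+k : (∀ i → spokeCut i ≡ false) → (∀ i → innerCut i ≡ false) →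
        ∀ i → outerCut (i + k) ≡ outerCut i
      outerCut-+k no-spoke no-inner i =
        cong₂ _xor_ (outerSide-+k i) (trans (cong outerSide (+-comm-swap i)) (outerSide-+k (i + 1)))
        where
        outerSide-+k : ∀ i → outerSide (i + k) ≡ outerSide i
        outerSide-+k i = trans (xor-false⇒≡ (no-spoke (i + k)))
                          (trans (sym (xor-false⇒≡ (no-inner i))) (sym (xor-false⇒≡ (no-spoke i))))
        +-comm-swap : ∀ i → i + k + 1 ≡ i + 1 + k
        +-comm-swap i = trans (+-assoc i k 1) (trans (cong (i +_) (+-comm k 1)) (sym (+-assoc i 1 k)))

      outerCut⇒cutSize≥3 : ∀ p → outerCut p ≡ true → 3 ≤ cutSize N k X
      outerCut⇒cutSize≥3 p cut-p with all-false-or-some-true spokeCut-cong | all-false-or-some-true innerCut-cong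
      ... | inj₂ (s , cut-s) | _                =
        cutSize-≥ (two-outerCuts p cut-p) (count-≥1 spokeCut-cong s cut-s) z≤n
      ... | inj₁ _           | inj₂ (t , cut-t) =
        cutSize-≥ (two-outerCuts p cut-p) z≤n (count-≥1 innerCut-cong t cut-t)
      ... | inj₁ no-spoke    | inj₁ no-inner    = cutSize-≥ three-outerCuts z≤n z≤n
        where
        shift = outerCut-+k no-spoke no-inner
        three-outerCuts : 3 ≤ count outerCut
        three-outerCuts = count-≥ outerCut-cong (p ∷ p + k ∷ p + k + k ∷ []) (three-apart p)
          (cut-p ∷ trans (shift p) cut-p ∷ trans (shift (p + k)) (trans (shift p) cut-p) ∷ [])

      module _ {c : Bool} (outer-c : ∀ i → outerSide i ≡ c) where

        spokeCut-at : ∀ i → innerSide i ≢ c → spokeCut i ≡ true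
        spokeCut-at i off = xor-≢ λ e → off (trans (sym e) (outer-c i))

        next-off⇒cutSize≥3 : ∀ j → innerSide j ≢ c → innerSide (j + k) ≢ c → 3 ≤ cutSize N k X
        next-off⇒cutSize≥3 j j-off jk-off with innerSide (j + k + k) Bool.≟ c
        ... | no jkk-off = cutSize-≥ z≤n
          (count-≥ spokeCut-cong (j ∷ j + k ∷ j + k + k ∷ []) (three-apart j)
            (spokeCut-at j j-off ∷ spokeCut-at (j + k) jk-off ∷ spokeCut-at (j + k + k) jkk-off ∷ []))
          z≤n
        ... | yes jkk-on = cutSize-≥ z≤n
          (count-≥2 spokeCut-cong j (j + k) (p≢p+k j) (spokeCut-at j j-off) (spokeCut-at (j + k) jk-off))
          (count-≥1 innerCut-cong (j + k) (xor-≢ λ e → jk-off (trans e jkk-on)))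

        -- q plays the role of j − k modulo N.
        next-on⇒cutSize≥3 : ∀ j → innerSide j ≢ c → innerSide (j + k) ≡ c → 3 ≤ cutSize N k X
        next-on⇒cutSize≥3 j j-off jk-on = by-cases (innerSide q Bool.≟ c)
          where
          q = j + (N ∸ k)
          q+k≈j : innerSide (q + k) ≡ innerSide j
          q+k≈j = begin
            innerSide (j + (N ∸ k) + k)   ≡⟨ cong innerSide (+-assoc j (N ∸ k) k) ⟩
            innerSide (j + (N ∸ k + k))   ≡⟨ cong (λ t → innerSide (j + t)) (m∸n+n≡m (<⇒≤ k<N)) ⟩
            innerSide (j + N)             ≡⟨ innerSide-cong (j + N) j ([m+n]%n≡m%n j N) ⟩
            innerSide j                   ∎
            where open ≡-Reasoning
          j≢q : j % N ≢ q % N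
          j≢q = %-shift-≢ j (m<n⇒0<n∸m k<N) (∸-monoʳ-< 0<k (<⇒≤ k<N))
          cut-j : innerCut j ≡ true
          cut-j = xor-≢ λ e → j-off (trans e jk-on)
          by-cases : Dec (innerSide q ≡ c) → 3 ≤ cutSize N k X
          by-cases (no q-off) = cutSize-≥ z≤n
            (count-≥2 spokeCut-cong j q j≢q (spokeCut-at j j-off) (spokeCut-at q q-off))
            (count-≥1 innerCut-cong j cut-j)
          by-cases (yes q-on) = cutSize-≥ z≤n
            (count-≥1 spokeCut-cong j (spokeCut-at j j-off))
            (count-≥2 innerCut-cong j q j≢q cut-j (xor-≢ λ e → j-off (trans (sym q+k≈j) (trans (sym e) q-on))))

        off⇒cutSize≥3 : ∀ j → innerSide j ≢ c → 3 ≤ cutSize N k X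
        off⇒cutSize≥3 j j-off with innerSide (j + k) Bool.≟ c
        ... | no  jk-off = next-off⇒cutSize≥3 j j-off jk-off
        ... | yes jk-on  = next-on⇒cutSize≥3 j j-off jk-on

      outer-constant : (∀ i → outerCut i ≡ false) → ∀ i → outerSide i ≡ outerSide 0
      outer-constant no-outer zero    = refl
      outer-constant no-outer (suc i) =
        trans (cong outerSide (+-comm 1 i)) (trans (sym (xor-false⇒≡ (no-outer i))) (outer-constant no-outer i))

      off-side : (Σ[ u ∈ Vtx N ] X u ≡ true) → (Σ[ v ∈ Vtx N ] X v ≡ false) → ∀ c → Σ[ w ∈ Vtx N ] X w ≢ c
      off-side _        (v , Xv) true  = v , λ Xv≡true → contradiction (trans (sym Xv) Xv≡true) λ ()
      off-side (u , Xu) _        false = u , λ Xu≡false → contradiction (trans (sym Xu) Xu≡false) λ ()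

      cutSize≥3 : (Σ[ u ∈ Vtx N ] X u ≡ true) → (Σ[ v ∈ Vtx N ] X v ≡ false) → 3 ≤ cutSize N k X
      cutSize≥3 u v with all-false-or-some-true outerCut-cong
      ... | inj₂ (p , cut-p) = outerCut⇒cutSize≥3 p cut-p
      ... | inj₁ no-outer with off-side u v (outerSide 0)
      ...   | xv f , off = contradiction (trans (cong (X ∘ xv) (sym (toℕ-mod-inverse f)))
                                              (outer-constant no-outer (toℕ f))) off
      ...   | yv f , off = off⇒cutSize≥3 (outer-constant no-outer) (toℕ f)
                             λ e → off (trans (cong (X ∘ yv) (sym (toℕ-mod-inverse f))) e)

    inSide : Bool → Vtx N → Bool
    inSide true  = X
    inSide false = not ∘ X

    inSide⁺ : ∀ b {u} → X u ≡ b → inSide b u ≡ true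
    inSide⁺ true  Xu = Xu
    inSide⁺ false Xu = cong not Xu

    inSide⁻ : ∀ b {u} → inSide b u ≡ true → X u ≡ b
    inSide⁻ true  Su = Su
    inSide⁻ false Su = not-injective Su

    module Part (b : Bool) = ConnectedSubgraph _≟ᵥ_ (vertices N) (vertices-unique N) (inSide b)

    walkIn : ∀ b {u v} → Walk N k X b u v → Part.WalkIn b (edges N k) u v
    walkIn b (stop Xu)        = Part.stop {b} (inSide⁺ b Xu)
    walkIn b (step Xu uw w→v) = Part.step {b} (inSide⁺ b Xu) uw (walkIn b w→v)

    connected-part-size : ∀ b → InducedConnected N k X b →
      Part.size b ≤ 1 + Part.internalEdges b (edges N k)
    connected-part-size b ((u₀ , Xu₀) , connected) =
      Part.connected⇒size≤1+internalEdges b (edges N k) (inSide⁺ b Xu₀)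
        λ u v Su Sv → walkIn b (connected u v (inSide⁻ b Su) (inSide⁻ b Sv))

    part-sizes : Part.size true + Part.size false ≡ N + N
    part-sizes = begin
      Part.size true + Part.size false                 ≡⟨ sum-map-+ (𝟙 ∘ X) (𝟙 ∘ not ∘ X) (vertices N) ⟨
      sum (map (λ u → 𝟙 (X u) + 𝟙 (not (X u))) (vertices N)) ≡⟨ sum-map-cong (vertices N) (λ u → one-side (X u)) ⟩
      sum (map (λ _ → 1) (vertices N))                 ≡⟨ sum-map-1 (vertices N) ⟩
      length (vertices N)                              ≡⟨ length-vertices N ⟩
      N + N                                            ∎
      where
      open ≡-Reasoning
      one-side : ∀ x → 𝟙 x + 𝟙 (not x) ≡ 1
      one-side true  = refl
      one-side false = refl

    edge-types : cutSize N k X + Part.internalEdges true (edges N k) + Part.internalEdges false (edges N k) ≡ N * 3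
    edge-types = begin
      sum (map cut E) + sum (map inX E) + sum (map inY E) ≡⟨ cong (_+ sum (map inY E)) (sum-map-+ cut inX E) ⟨
      sum (map (λ e → cut e + inX e) E) + sum (map inY E) ≡⟨ sum-map-+ (λ e → cut e + inX e) inY E ⟨
      sum (map (λ e → cut e + inX e + inY e) E)           ≡⟨ sum-map-cong E (λ (u , v) → one-type (X u) (X v)) ⟩
      sum (map (λ _ → 1) E)                               ≡⟨ sum-edges (λ _ → 1) ⟩
      ∑[ i < N ] 3                                        ≡⟨ ∑-const N 3 ⟩
      N * 3                                               ∎
      where
      open ≡-Reasoning
      E = edges N k
      cut inX inY : Vtx N × Vtx N → ℕ
      cut (u , v) = 𝟙 (X u xor X v)
      inX (u , v) = 𝟙 (X u ∧ X v)
      inY (u , v) = 𝟙 (not (X u) ∧ not (X v))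
      one-type : ∀ x y → 𝟙 (x xor y) + 𝟙 (x ∧ y) + 𝟙 (not x ∧ not y) ≡ 1
      one-type true  true  = refl
      one-type true  false = refl
      one-type false true  = refl
      one-type false false = refl

    cutSize≤N+2 : IsBond N k X → cutSize N k X ≤ N + 2
    cutSize≤N+2 (X-connected , Y-connected) = +-cancelʳ-≤ (N + N) (cutSize N k X) (N + 2) (begin
      cutSize N k X + (N + N)                            ≡⟨ cong (cutSize N k X +_) part-sizes ⟨
      cutSize N k X + (Part.size true + Part.size false) ≤⟨ +-monoʳ-≤ (cutSize N k X)
                                                              (+-mono-≤ (connected-part-size true X-connected)
                                                                        (connected-part-size false Y-connected)) ⟩
      cutSize N k X + (1 + eX + (1 + eY))                ≡⟨ rearrange (cutSize N k X) eX eY ⟩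
      cutSize N k X + eX + eY + 2                        ≡⟨ cong (_+ 2) edge-types ⟩
      N * 3 + 2                                          ≡⟨ triple N ⟩
      N + 2 + (N + N)                                    ∎)
      where
      open ≤-Reasoning
      eX = Part.internalEdges true (edges N k)
      eY = Part.internalEdges false (edges N k)
      rearrange : ∀ c a b → c + (1 + a + (1 + b)) ≡ c + a + b + 2
      rearrange = solve-∀
      triple : ∀ n → n * 3 + 2 ≡ n + 2 + (n + n)
      triple = solve-∀

  -- X = {x_i | i < j} ∪ {y_i | i < r}.  Its bond consists of the outer edges x_{j−1}x_j and x_{N−1}x_0,
  -- the spokes at r ≤ i < j, and the inner edges y_iy_{i+k} for i < r and for N − k ≤ i < N − k + r.
  module Block (j r : ℕ) where

    block : Side N
    block (xv f) = toℕ f <ᵇ j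
    block (yv f) = toℕ f <ᵇ r

    open Sides block

    outerSide-< : ∀ {i} → i < N → outerSide i ≡ (i <ᵇ j)
    outerSide-< {i} i<N = cong (_<ᵇ j) (trans (toℕ-mod i) (m<n⇒m%n≡m i<N))

    innerSide-< : ∀ {i} → i < N → innerSide i ≡ (i <ᵇ r)
    innerSide-< {i} i<N = cong (_<ᵇ r) (trans (toℕ-mod i) (m<n⇒m%n≡m i<N))

    module _ (0<k : 0 < k) (2k<N : k + k < N) (1≤j : 1 ≤ j) (j+k≤N : j + k ≤ N) (r≤k : r ≤ k) (r≤j : r ≤ j)
      where

      k<N : k < N
      k<N = m+n≤o⇒m≤o (suc k) 2k<N

      j≤m : j ≤ m
      j≤m = s≤s⁻¹ (<-≤-trans (m<m+n j 0<k) j+k≤N)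

      x₀-in : outerSide 0 ≡ true
      x₀-in = trans (outerSide-< (s≤s z≤n)) (<ᵇ-true 1≤j)

      xₘ-out : outerSide m ≡ false
      xₘ-out = trans (outerSide-< ≤-refl) (<ᵇ-false j≤m)

      x-walk-down : ∀ i → i < j → Walk N k block true (xv (i mod N)) (xv (0 mod N))
      x-walk-down zero    _     = stop x₀-in
      x-walk-down (suc i) i+1<j = step (trans (outerSide-< {suc i} (≤-trans i+1<j (m≤n⇒m≤1+n j≤m))) (<ᵇ-true i+1<j))
                                       (Adj-sym (outer-step i)) (x-walk-down i (<-trans (n<1+n i) i+1<j))

      to-x₀ : ∀ u → block u ≡ true → Walk N k block true u (xv (0 mod N))
      to-x₀ = walks-by-index
        (λ i i<N Xi → x-walk-down i (<ᵇ-true⁻ (trans (sym (outerSide-< i<N)) Xi)))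
        (λ i i<N Yi → step Yi (Adj-sym (spoke i))
                        (x-walk-down i (≤-trans (<ᵇ-true⁻ (trans (sym (innerSide-< i<N)) Yi)) r≤j)))

      x-walk-up : ∀ t i → i + t ≡ m → j ≤ i → Walk N k block false (xv (i mod N)) (xv (m mod N))
      x-walk-up zero    i i≡m j≤i rewrite +-identityʳ i | i≡m = stop xₘ-out
      x-walk-up (suc t) i i+t≡m j≤i =
        step (trans (outerSide-< (s≤s (≤-trans (m≤m+n i (suc t)) (≤-reflexive i+t≡m)))) (<ᵇ-false j≤i))
             (outer-step i) (x-walk-up t (suc i) (trans (sym (+-suc i t)) i+t≡m) (m≤n⇒m≤1+n j≤i))

      -- Inner steps y_i → y_{i+k} increase i while keeping it below N, so fuel N suffices.
      y-walk : ∀ fuel i → N ≤ i + fuel → r ≤ i → i < N → Walk N k block false (yv (i mod N)) (xv (m mod N))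
      y-walk zero       i N≤i   _   i<N = contradiction (subst (N ≤_) (+-identityʳ i) N≤i) (<⇒≱ i<N)
      y-walk (suc fuel) i N≤i+f r≤i i<N with j ≤? i
      ... | yes j≤i = step (trans (innerSide-< i<N) (<ᵇ-false r≤i)) (Adj-sym (spoke i))
                           (x-walk-up (m ∸ i) i (m+[n∸m]≡n (s≤s⁻¹ i<N)) j≤i)
      ... | no  j≰i = step (trans (innerSide-< i<N) (<ᵇ-false r≤i)) (inner-step i)
                           (y-walk fuel (i + k) N≤i+k+fuel (≤-trans r≤i (m≤m+n i k)) i+k<N)
        where
        i+k<N : i + k < N
        i+k<N = <-≤-trans (+-monoˡ-< k (≰⇒> j≰i)) j+k≤N
        N≤i+k+fuel : N ≤ i + k + fuel
        N≤i+k+fuel = ≤-trans N≤i+f (≤-trans (≤-reflexive (+-suc i fuel))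
          (+-monoˡ-≤ fuel (≤-trans (≤-reflexive (+-comm 1 i)) (+-monoʳ-≤ i 0<k))))

      to-xₘ : ∀ u → block u ≡ false → Walk N k block false u (xv (m mod N))
      to-xₘ = walks-by-index
        (λ i i<N Xi → x-walk-up (m ∸ i) i (m+[n∸m]≡n (s≤s⁻¹ i<N))
                        (<ᵇ-false⁻ (trans (sym (outerSide-< i<N)) Xi)))
        (λ i i<N Yi → y-walk N i (m≤n+m N i) (<ᵇ-false⁻ (trans (sym (innerSide-< i<N)) Yi)) i<N)

      block-bond : IsBond N k block
      block-bond = ((xv (0 mod N) , x₀-in) , connected-via-hub _ to-x₀)
                 , ((xv (m mod N) , xₘ-out) , connected-via-hub _ to-xₘ)

      xₘ₊₁-in : outerSide (m + 1) ≡ true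
      xₘ₊₁-in = trans (outerSide-cong (m + 1) 0 (trans (cong (_% N) (+-comm m 1)) (n%n≡0 N))) x₀-in

      m≢j∸1 : m ≢ j ∸ 1
      m≢j∸1 m≡j∸1 = <⇒≱ (∸-monoʳ-< {j} (s≤s z≤n) 1≤j) (≤-trans j≤m (≤-reflexive m≡j∸1))

      j∸1+1 : suc (j ∸ 1) ≡ j
      j∸1+1 = trans (+-comm 1 (j ∸ 1)) (m∸n+n≡m 1≤j)

      outerCut-at : ∀ i → i < N → 𝟙 (outerCut i) ≡ 𝟙 (i ≡ᵇ j ∸ 1) + 𝟙 (i ≡ᵇ m)
      outerCut-at i i<N with m≤n⇒m<n∨m≡n (s≤s⁻¹ i<N)
      ... | inj₂ refl rewrite xₘ-out | xₘ₊₁-in | ≡ᵇ-false m≢j∸1 | ≡ᵇ-refl m = refl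
      ... | inj₁ i<m rewrite outerSide-< i<N | outerSide-< {i + 1} (subst (_< N) (+-comm 1 i) (s≤s i<m))
                           | +-comm i 1 | ≡ᵇ-false (<⇒≢ i<m) | +-identityʳ (𝟙 (i ≡ᵇ j ∸ 1)) =
        cong 𝟙 (subst (λ J → ((i <ᵇ J) xor (suc i <ᵇ J)) ≡ (i ≡ᵇ j ∸ 1)) j∸1+1 (<ᵇ-suc-xor i (j ∸ 1)))

      spokeCut-at : ∀ i → i < N → 𝟙 (spokeCut i) + 𝟙 (i <ᵇ r) ≡ 𝟙 (i <ᵇ j)
      spokeCut-at i i<N rewrite outerSide-< i<N | innerSide-< i<N =
        𝟙-xor-⊆ λ i<r → <ᵇ-true (<-≤-trans (<ᵇ-true⁻ i<r) r≤j)

      d : ℕ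
      d = N ∸ k

      d+k≡N : d + k ≡ N
      d+k≡N = m∸n+n≡m (<⇒≤ k<N)

      r≤d : r ≤ d
      r≤d = ≤-trans r≤k (≤-trans (≤-reflexive (sym (m+n∸m≡n k k))) (∸-monoˡ-≤ k (<⇒≤ 2k<N)))

      innerSide-+k-unwrapped : ∀ {i} → i < d → innerSide (i + k) ≡ false
      innerSide-+k-unwrapped {i} i<d =
        trans (innerSide-< (subst (i + k <_) d+k≡N (+-monoˡ-< k i<d))) (<ᵇ-false (≤-trans r≤k (m≤n+m k i)))

      innerSide-+k-wrapped : ∀ {i} → d ≤ i → i < N → innerSide (i + k) ≡ (i <ᵇ d + r)
      innerSide-+k-wrapped {i} d≤i i<N = begin
        innerSide (i + k)       ≡⟨ innerSide-cong (i + k) w i+k≈w ⟩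
        innerSide w             ≡⟨ innerSide-< (≤-<-trans (m∸n≤m i d) i<N) ⟩
        (w <ᵇ r)                ≡⟨ <ᵇ-+ˡ d w r ⟨
        (d + w <ᵇ d + r)        ≡⟨ cong (_<ᵇ d + r) (m+[n∸m]≡n d≤i) ⟩
        (i <ᵇ d + r)            ∎
        where
        open ≡-Reasoning
        w = i ∸ d
        i+k≈w : (i + k) % N ≡ w % N
        i+k≈w = begin
          (i + k) % N           ≡⟨ cong (λ t → (t + k) % N) (m+[n∸m]≡n d≤i) ⟨
          (d + w + k) % N       ≡⟨ cong (_% N) (trans (+-assoc d w k) (trans (cong (d +_) (+-comm w k))
                                                                              (sym (+-assoc d k w)))) ⟩
          (d + k + w) % N       ≡⟨ cong (λ t → (t + w) % N) d+k≡N ⟩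
          (N + w) % N           ≡⟨ cong (_% N) (+-comm N w) ⟩
          (w + N) % N           ≡⟨ [m+n]%n≡m%n w N ⟩
          w % N                 ∎

      innerCut-at : ∀ i → i < N → 𝟙 (innerCut i) + 𝟙 (i <ᵇ d) ≡ 𝟙 (i <ᵇ r) + 𝟙 (i <ᵇ d + r)
      innerCut-at i i<N with i <? d
      ... | yes i<d rewrite innerSide-< i<N | innerSide-+k-unwrapped i<d | <ᵇ-true i<d
                          | <ᵇ-true (<-≤-trans i<d (m≤m+n d r)) | xor-identityʳ (i <ᵇ r) = refl
      ... | no  i≮d rewrite innerSide-< i<N | <ᵇ-false (≤-trans r≤d (≮⇒≥ i≮d)) | <ᵇ-false (≮⇒≥ i≮d)
                          | innerSide-+k-wrapped (≮⇒≥ i≮d) i<N = +-identityʳ _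

      count-outerCut : count outerCut ≡ 2
      count-outerCut = begin
        count outerCut                                    ≡⟨ ∑-cong N outerCut-at ⟩
        ∑[ i < N ] (𝟙 (i ≡ᵇ j ∸ 1) + 𝟙 (i ≡ᵇ m))          ≡⟨ ∑-distrib-+ N (λ i → 𝟙 (i ≡ᵇ j ∸ 1)) (λ i → 𝟙 (i ≡ᵇ m)) ⟩
        ∑[ i < N ] 𝟙 (i ≡ᵇ j ∸ 1) + ∑[ i < N ] 𝟙 (i ≡ᵇ m) ≡⟨ cong₂ _+_ (∑-≡ᵇ N (s≤s (≤-trans (m∸n≤m j 1) j≤m)))
                                                                    (∑-≡ᵇ N ≤-refl) ⟩
        2                                                 ∎
        where open ≡-Reasoning

      count-spokeCut : count spokeCut + r ≡ j
      count-spokeCut = begin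
        count spokeCut + r                         ≡⟨ cong (count spokeCut +_) (∑-<ᵇ N r≤N) ⟨
        count spokeCut + ∑[ i < N ] 𝟙 (i <ᵇ r)     ≡⟨ ∑-distrib-+ N (𝟙 ∘ spokeCut) (λ i → 𝟙 (i <ᵇ r)) ⟨
        ∑[ i < N ] (𝟙 (spokeCut i) + 𝟙 (i <ᵇ r))   ≡⟨ ∑-cong N spokeCut-at ⟩
        ∑[ i < N ] 𝟙 (i <ᵇ j)                      ≡⟨ ∑-<ᵇ N (m≤n⇒m≤1+n j≤m) ⟩
        j                                          ∎
        where
        open ≡-Reasoning
        r≤N = ≤-trans r≤j (m≤n⇒m≤1+n j≤m)

      count-innerCut : count innerCut ≡ r + r
      count-innerCut = +-cancelʳ-≡ d (count innerCut) (r + r) (begin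
        count innerCut + d                                ≡⟨ cong (count innerCut +_) (∑-<ᵇ N (m∸n≤m N k)) ⟨
        count innerCut + ∑[ i < N ] 𝟙 (i <ᵇ d)            ≡⟨ ∑-distrib-+ N (𝟙 ∘ innerCut) (λ i → 𝟙 (i <ᵇ d)) ⟨
        ∑[ i < N ] (𝟙 (innerCut i) + 𝟙 (i <ᵇ d))          ≡⟨ ∑-cong N innerCut-at ⟩
        ∑[ i < N ] (𝟙 (i <ᵇ r) + 𝟙 (i <ᵇ d + r))          ≡⟨ ∑-distrib-+ N (λ i → 𝟙 (i <ᵇ r)) (λ i → 𝟙 (i <ᵇ d + r)) ⟩
        ∑[ i < N ] 𝟙 (i <ᵇ r) + ∑[ i < N ] 𝟙 (i <ᵇ d + r) ≡⟨ cong₂ _+_ (∑-<ᵇ N (≤-trans r≤d (m∸n≤m N k)))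
                                                                    (∑-<ᵇ N d+r≤N) ⟩
        r + (d + r)                                       ≡⟨ cong (r +_) (+-comm d r) ⟩
        r + (r + d)                                       ≡⟨ +-assoc r r d ⟨
        r + r + d                                         ∎)
        where
        open ≡-Reasoning
        d+r≤N : d + r ≤ N
        d+r≤N = ≤-trans (+-monoʳ-≤ d r≤k) (≤-reflexive d+k≡N)

      block-cutSize : cutSize N k block ≡ j + r + 2
      block-cutSize = begin
        cutSize N k block                                ≡⟨ cutSize≡ ⟩
        count outerCut + count spokeCut + count innerCut ≡⟨ cong₂ (λ o i → o + count spokeCut + i)
                                                                   count-outerCut count-innerCut ⟩
        2 + count spokeCut + (r + r)                     ≡⟨ rearrange (count spokeCut) r ⟩
        count spokeCut + r + r + 2                       ≡⟨ cong (λ t → t + r + 2) count-spokeCut ⟩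
        j + r + 2                                        ∎
        where
        open ≡-Reasoning
        rearrange : ∀ s r → 2 + s + (r + r) ≡ s + r + r + 2
        rearrange = solve-∀

      block-in-coSpectrum : InCoSpectrum N k (j + r + 2)
      block-in-coSpectrum = block , block-bond , block-cutSize

  module _ (0<k : 0 < k) (2k<N : k + k < N) where

    k<N : k < N
    k<N = m+n≤o⇒m≤o (suc k) 2k<N

    N∸k+k≡N : N ∸ k + k ≡ N
    N∸k+k≡N = m∸n+n≡m (<⇒≤ k<N)

    short-block-in-coSpectrum : ∀ j → 1 ≤ j → j + k ≤ N → InCoSpectrum N k (j + 2)
    short-block-in-coSpectrum j 1≤j j+k≤N = subst (λ c → InCoSpectrum N k (c + 2)) (+-identityʳ j)
      (Block.block-in-coSpectrum j 0 0<k 2k<N 1≤j j+k≤N z≤n z≤n)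

    long-block-in-coSpectrum : ∀ r → r ≤ k → InCoSpectrum N k (N ∸ k + r + 2)
    long-block-in-coSpectrum r r≤k =
      Block.block-in-coSpectrum (N ∸ k) r 0<k 2k<N (m<n⇒0<n∸m k<N) (≤-reflexive N∸k+k≡N)
                                r≤k (≤-trans r≤k k≤N∸k)
      where
      k≤N∸k : k ≤ N ∸ k
      k≤N∸k = ≤-trans (≤-reflexive (sym (m+n∸m≡n k k))) (∸-monoˡ-≤ k (<⇒≤ 2k<N))

    in-coSpectrum : ∀ c → 3 ≤ c → c ≤ N + 2 → InCoSpectrum N k c
    in-coSpectrum c 3≤c c≤N+2 =
      subst (InCoSpectrum N k) (m∸n+n≡m (≤-trans (n≤1+n 2) 3≤c)) (by-length (c ∸ 2 ≤? N ∸ k))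
      where
      by-length : Dec (c ∸ 2 ≤ N ∸ k) → InCoSpectrum N k (c ∸ 2 + 2)
      by-length (yes short) = short-block-in-coSpectrum (c ∸ 2) (∸-monoˡ-≤ 2 3≤c)
                                (≤-trans (+-monoˡ-≤ k short) (≤-reflexive N∸k+k≡N))
      by-length (no  long)  = subst (λ l → InCoSpectrum N k (l + 2)) (m+[n∸m]≡n (<⇒≤ (≰⇒> long)))
        (long-block-in-coSpectrum (c ∸ 2 ∸ (N ∸ k)) (begin
          c ∸ 2 ∸ (N ∸ k)     ≤⟨ ∸-monoˡ-≤ (N ∸ k) (∸-monoˡ-≤ 2 c≤N+2) ⟩
          N + 2 ∸ 2 ∸ (N ∸ k) ≡⟨ cong (_∸ (N ∸ k)) (m+n∸n≡m N 2) ⟩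
          N ∸ (N ∸ k)         ≡⟨ m∸[m∸n]≡n (<⇒≤ k<N) ⟩
          k                   ∎))
        where open ≤-Reasoning

theorem1p6 : (n k : ℕ) → 3 ≤ n → 1 ≤ k → 2 * k < n →
    (m : ℕ) → InCoSpectrum n k m ⇔ (3 ≤ m × m ≤ n + 2)
theorem1p6 (suc m) k _ 0<k 2k<n c = mk⇔
  (λ (X , bond , X-cut≡c) →
       subst (3 ≤_) X-cut≡c (Sides.LowerBound.cutSize≥3 X 0<k 2k<N (proj₁ (proj₁ bond)) (proj₁ (proj₂ bond)))
     , subst (_≤ suc m + 2) X-cut≡c (Sides.cutSize≤N+2 X bond))
  (λ (3≤c , c≤N+2) → in-coSpectrum 0<k 2k<N c 3≤c c≤N+2)
  where
  open PetersenGraph m k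
  2k<N : k + k < suc m
  2k<N = subst (λ t → k + t < suc m) (+-identityʳ k) 2k<n
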